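{- Let $G$ be a chordal graph with no universal vertex and let $s$ be a simplicial vertex of $G$. Let $\{v_0,v_1,v_2\}$ be a clique of $G^{s}$ with $v_1,v_2\in N_G(s)$ and $v_0\in V(G)\setminus N_G[s]$. If the clique $\{v_0,v_1,v_2\}$ has no witness, then $\{v_0,v_1,v_2\}$ is a clique of $G$.
   Context: A vertex is simplicial if its closed neighbourhood is a clique. $G^{s}$ is the graph on $V(G)$ with edges: two vertices of $V(G)\setminus N_G[s]$ are adjacent iff adjacent in $G$; two distinct $u,v\in N_G[s]$ are adjacent iff $N_G(u)\cup N_G(v)\ne V(G)$; $u\in N_G[s]$ and $v\in V(G)\setminus N_G[s]$ are adjacent iff $N_G[v]\not\subseteq N_G[u]$. For a clique $K$ of $G^{s}$, a vertex $w\in V(G)\setminus N_G[s]$ is a witness of $K$ if $N_G[w]\cap K$ and $N_G[s]\cap K$ are disjoint and their union is $K$. -}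

module Defs where

open import Data.Nat using (ℕ; zero; suc; _≤_)
open import Data.Fin using (Fin; toℕ)
open import Data.Product using (Σ; ∃; ∃₂; _×_; _,_)
open import Data.Sum using (_⊎_)
open import Data.Empty using (⊥)
open import Relation.Nullary using (¬_; Dec)
open import Relation.Binary.PropositionalEquality using (_≡_; _≢_)
open import Function using (Injective)

record Graph (n : ℕ) : Set₁ where
  field
    Adj   : Fin n → Fin n → Set
    adj?  : ∀ u v → Dec (Adj u v)
    sym   : ∀ {u v} → Adj u v → Adj v u
    irrefl : ∀ {u} → ¬ Adj u u

module _ {n : ℕ} (G : Graph n) where
  open Graph G

  N : Fin n → Fin n → Set
  N v u = Adj v u

  N[_] : Fin n → Fin n → Set
  N[ v ] u = u ≡ v ⊎ Adj v u

  IsClique : (Fin n → Set) → Set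
  IsClique K = ∀ x y → K x → K y → x ≢ y → Adj x y

  Universal : Fin n → Set
  Universal v = ∀ u → u ≢ v → Adj v u

  NoUniversalVertex : Set
  NoUniversalVertex = ¬ (Σ (Fin n) Universal)

  Simplicial : Fin n → Set
  Simplicial s = IsClique N[ s ]

  CycConsec : (k : ℕ) → Fin k → Fin k → Set
  CycConsec k i j =
    suc (toℕ i) ≡ toℕ j ⊎ suc (toℕ j) ≡ toℕ i
    ⊎ (toℕ i ≡ 0 × suc (toℕ j) ≡ k) ⊎ (toℕ j ≡ 0 × suc (toℕ i) ≡ k)

  IsCycle : (k : ℕ) → (Fin k → Fin n) → Set
  IsCycle k c = 3 ≤ k × Injective _≡_ _≡_ c × (∀ i j → CycConsec k i j → Adj (c i) (c j))

  HasChord : (k : ℕ) → (Fin k → Fin n) → Set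
  HasChord k c = ∃₂ λ i j → i ≢ j × ¬ CycConsec k i j × Adj (c i) (c j)

  Chordal : Set
  Chordal = ∀ k (c : Fin k → Fin n) → 4 ≤ k → IsCycle k c → HasChord k c

  AdjS : Fin n → Fin n → Fin n → Set
  AdjS s u v =
      (¬ N[ s ] u × ¬ N[ s ] v × Adj u v)
    ⊎ (N[ s ] u × N[ s ] v × u ≢ v × ¬ (∀ w → N u w ⊎ N v w))
    ⊎ (N[ s ] u × ¬ N[ s ] v × ¬ (∀ w → N[ v ] w → N[ u ] w))
    ⊎ (¬ N[ s ] u × N[ s ] v × ¬ (∀ w → N[ u ] w → N[ v ] w))

  IsCliqueS : Fin n → (Fin n → Set) → Set
  IsCliqueS s K = ∀ x y → K x → K y → x ≢ y → AdjS s x y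

  Witness : Fin n → (Fin n → Set) → Fin n → Set
  Witness s K w =
    ¬ N[ s ] w
    × (∀ x → ¬ ((N[ w ] x × K x) × (N[ s ] x × K x)))
    × (∀ x → ((N[ w ] x × K x) ⊎ (N[ s ] x × K x)) → K x)
    × (∀ x → K x → (N[ w ] x × K x) ⊎ (N[ s ] x × K x))

｛_,_,_｝ : {n : ℕ} → Fin n → Fin n → Fin n → Fin n → Set
｛ a , b , c ｝ x = x ≡ a ⊎ x ≡ b ⊎ x ≡ c

{-# OPTIONS --safe #-}
-- Simpliciality of s gives N[s] ⊆ N[a] for every a ∈ N(s), so a vertex y ∈ N[v₀] ∖ N[a] lies
-- outside N[s] and is a neighbour of v₀. If v₀ saw v₁ but not v₂, such a y exists for a = v₁
-- because v₀v₁ is an edge of Gˢ; as y is no witness it must see v₂, and then v₀ y v₂ v₁ is a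
-- chordless 4-cycle. That v₀ sees v₁ or v₂ at all holds because v₀ itself is no witness.
module Submission where

open import Defs
open import Data.Nat using (ℕ; _+_)
open import Data.Nat.Properties using (≤-refl; n≤1+n)
open import Data.Fin using (Fin; zero; suc; toℕ; _≟_)
open import Data.Fin.Properties using (¬∀⟶∃¬)
open import Data.Product using (Σ; ∃; _,_; _×_; proj₂)
open import Data.Sum using (_⊎_; inj₁; inj₂; [_,_]; swap)
open import Data.Empty using (⊥-elim)
open import Function using (const; _∘_)
open import Relation.Nullary using (¬_; Dec; yes; no; contradiction)
open import Relation.Nullary.Decidable using (_⊎-dec_; _→-dec_; decidable-stable)
open import Relation.Binary.PropositionalEquality using (_≡_; _≢_; refl; sym)

module _ {n : ℕ} (G : Graph n) where
  open Graph G renaming (sym to Adj-sym)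

  Adj⇒≢ : ∀ {u v} → Adj u v → u ≢ v
  Adj⇒≢ uv refl = irrefl uv

  N[_]? : ∀ v u → Dec (N[_] G v u)
  N[ v ]? u = (u ≟ v) ⊎-dec adj? v u

  N[]-sym : ∀ {u v} → N[_] G u v → N[_] G v u
  N[]-sym (inj₁ refl) = inj₁ refl
  N[]-sym (inj₂ uv)   = inj₂ (Adj-sym uv)

  N[]∧≢⇒Adj : ∀ {u v} → N[_] G u v → v ≢ u → Adj u v
  N[]∧≢⇒Adj (inj₁ v≡u) v≢u = contradiction v≡u v≢u
  N[]∧≢⇒Adj (inj₂ uv)  _   = uv

  ¬⊆⇒∃∈∖ : ∀ {u v} → ¬ (∀ w → N[_] G u w → N[_] G v w) →
           ∃ λ w → N[_] G u w × ¬ N[_] G v w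
  ¬⊆⇒∃∈∖ {u} {v} N[u]⊈N[v] with ¬∀⟶∃¬ n _ (λ w → N[ u ]? w →-dec N[ v ]? w) N[u]⊈N[v]
  ... | w , ¬[w∈N[u]→w∈N[v]] =
    w , decidable-stable (N[ u ]? w) (λ w∉N[u] → ¬[w∈N[u]→w∈N[v]] (λ w∈N[u] → contradiction w∈N[u] w∉N[u]))
      , ¬[w∈N[u]→w∈N[v]] ∘ const

  simplicial⇒N[s]⊆N[a] : ∀ {s a} → Simplicial G s → N[_] G s a → ∀ w → N[_] G s w → N[_] G a w
  simplicial⇒N[s]⊆N[a] {a = a} simplicial a∈N[s] w w∈N[s] with w ≟ a
  ... | yes w≡a = inj₁ w≡a
  ... | no  w≢a = inj₂ (simplicial a w a∈N[s] w∈N[s] (w≢a ∘ sym))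

  AdjS⇒N[]⊈ : ∀ {s u v} → ¬ N[_] G s u → N[_] G s v → AdjS G s u v →
              ¬ (∀ w → N[_] G u w → N[_] G v w)
  AdjS⇒N[]⊈ _      v∈N[s] (inj₁ (_ , v∉N[s] , _))                 = contradiction v∈N[s] v∉N[s]
  AdjS⇒N[]⊈ u∉N[s] _      (inj₂ (inj₁ (u∈N[s] , _)))              = contradiction u∈N[s] u∉N[s]
  AdjS⇒N[]⊈ u∉N[s] _      (inj₂ (inj₂ (inj₁ (u∈N[s] , _))))       = contradiction u∈N[s] u∉N[s]
  AdjS⇒N[]⊈ _      _      (inj₂ (inj₂ (inj₂ (_ , _ , N[u]⊈N[v])))) = N[u]⊈N[v]

  module Square {a b c d : Fin n} (a≢c : a ≢ c) (b≢d : b ≢ d)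
                (ab : Adj a b) (bc : Adj b c) (cd : Adj c d) (da : Adj d a) where

    vertex : Fin 4 → Fin n
    vertex zero                   = a
    vertex (suc zero)             = b
    vertex (suc (suc zero))       = c
    vertex (suc (suc (suc zero))) = d

    successor-edge : ∀ i j → 1 + toℕ i ≡ toℕ j → Adj (vertex i) (vertex j)
    successor-edge zero                   (suc zero)                   _ = ab
    successor-edge (suc zero)             (suc (suc zero))             _ = bc
    successor-edge (suc (suc zero))       (suc (suc (suc zero)))       _ = cd
    successor-edge zero                   zero                         ()
    successor-edge zero                   (suc (suc _))                ()
    successor-edge (suc zero)             zero                         ()
    successor-edge (suc zero)             (suc zero)                   ()
    successor-edge (suc zero)             (suc (suc (suc _)))          ()
    successor-edge (suc (suc zero))       zero                         ()
    successor-edge (suc (suc zero))       (suc zero)                   ()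
    successor-edge (suc (suc zero))       (suc (suc zero))             ()
    successor-edge (suc (suc (suc zero))) zero                         ()
    successor-edge (suc (suc (suc zero))) (suc zero)                   ()
    successor-edge (suc (suc (suc zero))) (suc (suc zero))             ()
    successor-edge (suc (suc (suc zero))) (suc (suc (suc zero)))       ()

    closing-edge : ∀ i j → toℕ i ≡ 0 → 1 + toℕ j ≡ 4 → Adj (vertex i) (vertex j)
    closing-edge zero (suc (suc (suc zero))) _ _ = Adj-sym da
    closing-edge zero zero                   _ ()
    closing-edge zero (suc zero)             _ ()
    closing-edge zero (suc (suc zero))       _ ()

    edge : ∀ i j → CycConsec G 4 i j → Adj (vertex i) (vertex j)
    edge i j (inj₁ i+1≡j)                      = successor-edge i j i+1≡j
    edge i j (inj₂ (inj₁ j+1≡i))               = Adj-sym (successor-edge j i j+1≡i)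
    edge i j (inj₂ (inj₂ (inj₁ (i≡0 , j+1≡4)))) = closing-edge i j i≡0 j+1≡4
    edge i j (inj₂ (inj₂ (inj₂ (j≡0 , i+1≡4)))) = Adj-sym (closing-edge j i j≡0 i+1≡4)

    injective : ∀ {i j} → vertex i ≡ vertex j → i ≡ j
    injective {zero}                   {zero}                   _ = refl
    injective {suc zero}               {suc zero}               _ = refl
    injective {suc (suc zero)}         {suc (suc zero)}         _ = refl
    injective {suc (suc (suc zero))}   {suc (suc (suc zero))}   _ = refl
    injective {zero}                   {suc zero}               e = contradiction e (Adj⇒≢ ab)
    injective {suc zero}               {suc (suc zero)}         e = contradiction e (Adj⇒≢ bc)
    injective {suc (suc zero)}         {suc (suc (suc zero))}   e = contradiction e (Adj⇒≢ cd)
    injective {suc (suc (suc zero))}   {zero}                   e = contradiction e (Adj⇒≢ da)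
    injective {suc zero}               {zero}                   e = contradiction (sym e) (Adj⇒≢ ab)
    injective {suc (suc zero)}         {suc zero}               e = contradiction (sym e) (Adj⇒≢ bc)
    injective {suc (suc (suc zero))}   {suc (suc zero)}         e = contradiction (sym e) (Adj⇒≢ cd)
    injective {zero}                   {suc (suc (suc zero))}   e = contradiction (sym e) (Adj⇒≢ da)
    injective {zero}                   {suc (suc zero)}         e = contradiction e a≢c
    injective {suc (suc zero)}         {zero}                   e = contradiction (sym e) a≢c
    injective {suc zero}               {suc (suc (suc zero))}   e = contradiction e b≢d
    injective {suc (suc (suc zero))}   {suc zero}               e = contradiction (sym e) b≢d

    isCycle : IsCycle G 4 vertex
    isCycle = n≤1+n 3 , injective , edge

    chord⇒diagonal : ∀ i j → ¬ CycConsec G 4 i j → Adj (vertex i) (vertex j) → Adj a c ⊎ Adj b d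
    chord⇒diagonal zero                   (suc (suc zero))       _ ac = inj₁ ac
    chord⇒diagonal (suc (suc zero))       zero                   _ ca = inj₁ (Adj-sym ca)
    chord⇒diagonal (suc zero)             (suc (suc (suc zero))) _ bd = inj₂ bd
    chord⇒diagonal (suc (suc (suc zero))) (suc zero)             _ db = inj₂ (Adj-sym db)
    chord⇒diagonal zero                   zero                   _ aa = ⊥-elim (irrefl aa)
    chord⇒diagonal (suc zero)             (suc zero)             _ bb = ⊥-elim (irrefl bb)
    chord⇒diagonal (suc (suc zero))       (suc (suc zero))       _ cc = ⊥-elim (irrefl cc)
    chord⇒diagonal (suc (suc (suc zero))) (suc (suc (suc zero))) _ dd = ⊥-elim (irrefl dd)
    chord⇒diagonal zero                   (suc zero)             ¬consec _ = contradiction (inj₁ refl) ¬consec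
    chord⇒diagonal (suc zero)             (suc (suc zero))       ¬consec _ = contradiction (inj₁ refl) ¬consec
    chord⇒diagonal (suc (suc zero))       (suc (suc (suc zero))) ¬consec _ = contradiction (inj₁ refl) ¬consec
    chord⇒diagonal (suc zero)             zero                   ¬consec _ = contradiction (inj₂ (inj₁ refl)) ¬consec
    chord⇒diagonal (suc (suc zero))       (suc zero)             ¬consec _ = contradiction (inj₂ (inj₁ refl)) ¬consec
    chord⇒diagonal (suc (suc (suc zero))) (suc (suc zero))       ¬consec _ = contradiction (inj₂ (inj₁ refl)) ¬consec
    chord⇒diagonal zero                   (suc (suc (suc zero))) ¬consec _ = contradiction (inj₂ (inj₂ (inj₁ (refl , refl)))) ¬consec
    chord⇒diagonal (suc (suc (suc zero))) zero                   ¬consec _ = contradiction (inj₂ (inj₂ (inj₂ (refl , refl)))) ¬consec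

  square-has-diagonal : Chordal G → ∀ {a b c d} → a ≢ c → b ≢ d →
                        Adj a b → Adj b c → Adj c d → Adj d a → Adj a c ⊎ Adj b d
  square-has-diagonal chordal a≢c b≢d ab bc cd da =
    let i , j , _ , ¬consec , chord = chordal 4 vertex ≤-refl isCycle
    in  chord⇒diagonal i j ¬consec chord
    where open Square a≢c b≢d ab bc cd da

  witness-of-triple : ∀ {s v₀ v₁ v₂ w} → ¬ N[_] G s v₀ → N G s v₁ → N G s v₂ →
                      ¬ N[_] G s w → N[_] G w v₀ → ¬ N[_] G w v₁ → ¬ N[_] G w v₂ →
                      Witness G s ｛ v₀ , v₁ , v₂ ｝ w
  witness-of-triple {s} {v₀} {v₁} {v₂} {w} v₀∉N[s] sv₁ sv₂ w∉N[s] v₀∈N[w] v₁∉N[w] v₂∉N[w] =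
    w∉N[s] , disjoint , (λ _ → [ proj₂ , proj₂ ]) , covered
    where
    disjoint : ∀ x → ¬ ((N[_] G w x × ｛ v₀ , v₁ , v₂ ｝ x) × (N[_] G s x × ｛ v₀ , v₁ , v₂ ｝ x))
    disjoint x ((_       , inj₁ refl)        , (x∈N[s] , _)) = v₀∉N[s] x∈N[s]
    disjoint x ((x∈N[w] , inj₂ (inj₁ refl)) , _)            = v₁∉N[w] x∈N[w]
    disjoint x ((x∈N[w] , inj₂ (inj₂ refl)) , _)            = v₂∉N[w] x∈N[w]

    covered : ∀ x → ｛ v₀ , v₁ , v₂ ｝ x →
              (N[_] G w x × ｛ v₀ , v₁ , v₂ ｝ x) ⊎ (N[_] G s x × ｛ v₀ , v₁ , v₂ ｝ x)
    covered x x∈K@(inj₁ refl)        = inj₁ (v₀∈N[w] , x∈K)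
    covered x x∈K@(inj₂ (inj₁ refl)) = inj₂ (inj₂ sv₁ , x∈K)
    covered x x∈K@(inj₂ (inj₂ refl)) = inj₂ (inj₂ sv₂ , x∈K)

  no-witness⇒sees-v₁-or-v₂ : ∀ {s v₀ v₁ v₂} → ¬ N[_] G s v₀ → N G s v₁ → N G s v₂ →
                             ¬ Σ (Fin n) (Witness G s ｛ v₀ , v₁ , v₂ ｝) →
                             ∀ w → ¬ N[_] G s w → N[_] G w v₀ → N[_] G w v₁ ⊎ N[_] G w v₂
  no-witness⇒sees-v₁-or-v₂ v₀∉N[s] sv₁ sv₂ noWitness w w∉N[s] v₀∈N[w] =
    decidable-stable (N[ w ]? _ ⊎-dec N[ w ]? _) λ sees-neither →
      noWitness (w , witness-of-triple v₀∉N[s] sv₁ sv₂ w∉N[s] v₀∈N[w] (sees-neither ∘ inj₁) (sees-neither ∘ inj₂))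

  sees-one⇒sees-other : Chordal G → ∀ {s v₀ a b} → Simplicial G s → ¬ N[_] G s v₀ → N G s a → N G s b →
                        ¬ (∀ w → N[_] G v₀ w → N[_] G a w) →
                        (∀ w → ¬ N[_] G s w → N[_] G w v₀ → N[_] G w a ⊎ N[_] G w b) →
                        Adj v₀ a → Adj v₀ b
  sees-one⇒sees-other chordal {s} {v₀} {a} {b} simplicial v₀∉N[s] sa sb N[v₀]⊈N[a] sees-a-or-b v₀a
    with adj? v₀ b
  ... | yes v₀b = v₀b
  ... | no  v₀≁b with ¬⊆⇒∃∈∖ N[v₀]⊈N[a]
  ... | y , y∈N[v₀] , y∉N[a] =
    contradiction (square-has-diagonal chordal v₀≢b y≢a v₀y yb (Adj-sym ab) (Adj-sym v₀a)) [ v₀≁b , y≁a ]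
    where
    y≢a : y ≢ a
    y≢a = y∉N[a] ∘ inj₁

    y≁a : ¬ Adj y a
    y≁a = y∉N[a] ∘ inj₂ ∘ Adj-sym

    v₀y : Adj v₀ y
    v₀y = N[]∧≢⇒Adj y∈N[v₀] λ { refl → y∉N[a] (inj₂ (Adj-sym v₀a)) }

    y∉N[s] : ¬ N[_] G s y
    y∉N[s] = y∉N[a] ∘ simplicial⇒N[s]⊆N[a] simplicial (inj₂ sa) y

    yb : Adj y b
    yb = [ (λ a∈N[y] → contradiction (N[]-sym a∈N[y]) y∉N[a])
         , (λ b∈N[y] → N[]∧≢⇒Adj b∈N[y] λ { refl → v₀≁b v₀y }) ]
         (sees-a-or-b y y∉N[s] (inj₂ (Adj-sym v₀y)))

    v₀≢b : v₀ ≢ b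
    v₀≢b refl = v₀∉N[s] (inj₂ sb)

    ab : Adj a b
    ab = simplicial a b (inj₂ sa) (inj₂ sb) λ { refl → v₀≁b v₀a }

  IsClique-｛｝ : ∀ {a b c} → Adj a b → Adj a c → (b ≢ c → Adj b c) → IsClique G ｛ a , b , c ｝
  IsClique-｛｝ ab ac bc _ _ (inj₁ refl)        (inj₁ refl)        x≢y = contradiction refl x≢y
  IsClique-｛｝ ab ac bc _ _ (inj₁ refl)        (inj₂ (inj₁ refl)) _   = ab
  IsClique-｛｝ ab ac bc _ _ (inj₁ refl)        (inj₂ (inj₂ refl)) _   = ac
  IsClique-｛｝ ab ac bc _ _ (inj₂ (inj₁ refl)) (inj₁ refl)        _   = Adj-sym ab
  IsClique-｛｝ ab ac bc _ _ (inj₂ (inj₁ refl)) (inj₂ (inj₁ refl)) x≢y = contradiction refl x≢y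
  IsClique-｛｝ ab ac bc _ _ (inj₂ (inj₁ refl)) (inj₂ (inj₂ refl)) x≢y = bc x≢y
  IsClique-｛｝ ab ac bc _ _ (inj₂ (inj₂ refl)) (inj₁ refl)        _   = Adj-sym ac
  IsClique-｛｝ ab ac bc _ _ (inj₂ (inj₂ refl)) (inj₂ (inj₁ refl)) x≢y = Adj-sym (bc (x≢y ∘ sym))
  IsClique-｛｝ ab ac bc _ _ (inj₂ (inj₂ refl)) (inj₂ (inj₂ refl)) x≢y = contradiction refl x≢y

proposition3p6 : ∀ {n : ℕ} (G : Graph n) → Chordal G → NoUniversalVertex G
    → (s : Fin n) → Simplicial G s
    → (v₀ v₁ v₂ : Fin n)
    → IsCliqueS G s ｛ v₀ , v₁ , v₂ ｝
    → N G s v₁ → N G s v₂ → ¬ N[_] G s v₀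
    → ¬ (Σ (Fin n) (Witness G s ｛ v₀ , v₁ , v₂ ｝))
    → IsClique G ｛ v₀ , v₁ , v₂ ｝
proposition3p6 G chordal _ s simplicial v₀ v₁ v₂ cliqueˢ sv₁ sv₂ v₀∉N[s] noWitness =
  IsClique-｛｝ G v₀v₁ v₀v₂ (simplicial v₁ v₂ (inj₂ sv₁) (inj₂ sv₂))
  where
  open Graph G using (Adj)

  sees-v₁-or-v₂ : ∀ w → ¬ N[_] G s w → N[_] G w v₀ → N[_] G w v₁ ⊎ N[_] G w v₂
  sees-v₁-or-v₂ = no-witness⇒sees-v₁-or-v₂ G v₀∉N[s] sv₁ sv₂ noWitness

  v₀≢v₁ : v₀ ≢ v₁
  v₀≢v₁ refl = v₀∉N[s] (inj₂ sv₁)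

  v₀≢v₂ : v₀ ≢ v₂
  v₀≢v₂ refl = v₀∉N[s] (inj₂ sv₂)

  N[v₀]⊈N[v₁] : ¬ (∀ w → N[_] G v₀ w → N[_] G v₁ w)
  N[v₀]⊈N[v₁] = AdjS⇒N[]⊈ G v₀∉N[s] (inj₂ sv₁) (cliqueˢ v₀ v₁ (inj₁ refl) (inj₂ (inj₁ refl)) v₀≢v₁)

  N[v₀]⊈N[v₂] : ¬ (∀ w → N[_] G v₀ w → N[_] G v₂ w)
  N[v₀]⊈N[v₂] = AdjS⇒N[]⊈ G v₀∉N[s] (inj₂ sv₂) (cliqueˢ v₀ v₂ (inj₁ refl) (inj₂ (inj₂ refl)) v₀≢v₂)

  v₀v₁ : Adj v₀ v₁
  v₀v₁ with sees-v₁-or-v₂ v₀ v₀∉N[s] (inj₁ refl)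
  ... | inj₁ v₁∈N[v₀] = N[]∧≢⇒Adj G v₁∈N[v₀] (v₀≢v₁ ∘ sym)
  ... | inj₂ v₂∈N[v₀] = sees-one⇒sees-other G chordal simplicial v₀∉N[s] sv₂ sv₁ N[v₀]⊈N[v₂]
                          (λ w w∉N[s] → swap ∘ sees-v₁-or-v₂ w w∉N[s]) (N[]∧≢⇒Adj G v₂∈N[v₀] (v₀≢v₂ ∘ sym))

  v₀v₂ : Adj v₀ v₂
  v₀v₂ = sees-one⇒sees-other G chordal simplicial v₀∉N[s] sv₁ sv₂ N[v₀]⊈N[v₁] sees-v₁-or-v₂ v₀v₁
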